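{- Let $p$ and $q$ be prime numbers with $q=p+2$, and let $C'$ be the curve $y^2=-x^4+(p+q)x^2-pq$. Then: (i) $C'$ has a point with both coordinates in $\mathbf{Z}$ if and only if $p=3$. (ii) $C'$ has a point with both coordinates in $\mathbf{Q}$ if and only if at least one of the systems $$\text{(I)}\quad X^2-pY^2=S^2,\ \ X^2-qY^2=-T^2,\qquad\text{(II)}\quad X^2-pY^2=2S^2,\ \ X^2-qY^2=-2T^2$$ has a primary solution, i.e. a solution $(X,Y,S,T)\in\mathbf{Z}^4$ with $\gcd(X,Y)=1$. (iii) If there are integers $a,b,c$ and $\varepsilon,\delta\in\{+1,-1\}$ with $q=a^2+b^2$ and $(a+\varepsilon)^2+(b+\delta)^2=c^2$, then system (I) has a primary solution, and $C'$ has a point with both coordinates in $\mathbf{Q}$. -}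

module Defs where

open import Data.Nat as ℕ using (ℕ)
open import Data.Integer as ℤ using (ℤ; +_)
open import Data.Integer.GCD using (gcd)
open import Data.Rational as ℚ using (ℚ)
open import Data.Product using (Σ; _×_; ∃)
open import Relation.Binary.PropositionalEquality using (_≡_)

ℤtoℚ : ℤ → ℚ
ℤtoℚ z = z ℚ./ 1

ℕtoℚ : ℕ → ℚ
ℕtoℚ n = ℤtoℚ (+ n)

OnCurveℤ : ℕ → ℕ → ℤ → ℤ → Set
OnCurveℤ p q x y =
  y ℤ.* y ≡ (ℤ.- (x ℤ.* x ℤ.* x ℤ.* x)) ℤ.+ (+ (p ℕ.+ q)) ℤ.* (x ℤ.* x) ℤ.- + (p ℕ.* q)

OnCurveℚ : ℕ → ℕ → ℚ → ℚ → Set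
OnCurveℚ p q x y =
  y ℚ.* y ≡ (ℚ.- (x ℚ.* x ℚ.* x ℚ.* x)) ℚ.+ ℕtoℚ (p ℕ.+ q) ℚ.* (x ℚ.* x) ℚ.- ℕtoℚ (p ℕ.* q)

HasIntegerPoint : ℕ → ℕ → Set
HasIntegerPoint p q = Σ ℤ λ x → Σ ℤ λ y → OnCurveℤ p q x y

HasRationalPoint : ℕ → ℕ → Set
HasRationalPoint p q = Σ ℚ λ x → Σ ℚ λ y → OnCurveℚ p q x y

SystemI : ℕ → ℕ → ℤ → ℤ → ℤ → ℤ → Set
SystemI p q X Y S T =
  (X ℤ.* X ℤ.- (+ p) ℤ.* (Y ℤ.* Y) ≡ S ℤ.* S) ×
  (X ℤ.* X ℤ.- (+ q) ℤ.* (Y ℤ.* Y) ≡ ℤ.- (T ℤ.* T))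

SystemII : ℕ → ℕ → ℤ → ℤ → ℤ → ℤ → Set
SystemII p q X Y S T =
  (X ℤ.* X ℤ.- (+ p) ℤ.* (Y ℤ.* Y) ≡ (+ 2) ℤ.* (S ℤ.* S)) ×
  (X ℤ.* X ℤ.- (+ q) ℤ.* (Y ℤ.* Y) ≡ ℤ.- ((+ 2) ℤ.* (T ℤ.* T)))

HasPrimarySolution : (ℤ → ℤ → ℤ → ℤ → Set) → Set
HasPrimarySolution Sys =
  Σ ℤ λ X → Σ ℤ λ Y → Σ ℤ λ S → Σ ℤ λ T →
    (gcd X Y ≡ + 1) × Sys X Y S T

-- Write a rational point as x = n/d in lowest terms. Clearing denominators turns y² = −x⁴ + (p + q)x² − pq
-- into z² = (n² − pd²)(qd² − n²) for a natural number z, and since p ≤ q both factors are nonnegative. They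
-- sum to 2d², so their gcd k divides 2n² and 2d², hence 2 as n and d are coprime; as their product is a
-- square, each of them is k times a square, which is a primitive solution of (I) for k = 1 and of (II) for
-- k = 2. Conversely a solution gives back z = kST. An integral point is the case d = 1, where the two factors
-- sum to 2: only n² = p + 1 survives, and that forces p = 3. For (iii), X = q + εa + δb, Y = c solves (I) by
-- a polynomial identity, and dividing by gcd(X, Y) makes the solution primary.

module Submission where

open import Defs
open import Data.Nat using (ℕ; _+_)
open import Data.Nat.Primality using (Prime)
open import Data.Integer as ℤ using (ℤ; +_; -[1+_])
open import Data.Product using (Σ; _×_)
open import Data.Sum using (_⊎_)
open import Function.Bundles using (_⇔_)
open import Relation.Binary.PropositionalEquality using (_≡_)

open import Data.Nat using (zero; suc; _*_; _∸_; _≤_; _≤?_; NonZero; ≢-nonZero; ≢-nonZero⁻¹; >-nonZero; z≤n; s≤s)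
open import Data.Nat.Properties
open import Data.Nat.Divisibility
open import Data.Nat.DivMod using (_/_; m*[n/m]≡n)
open import Data.Nat.GCD
open import Data.Nat.Coprimality as Coprimality using (Coprime; coprime-divisor; coprime⇒gcd≡1; coprime-/gcd)
open import Data.Nat.Primality using (composite; prime⇒¬composite; ¬prime[0]; ¬prime[1]; irreducible[2])
open import Data.Nat.Tactic.RingSolver using (solve-∀)
open import Algebra.Properties.CommutativeSemigroup *-commutativeSemigroup using (interchange)
open import Data.Product using (_,_; ∃₂; proj₁; proj₂)
open import Data.Sum as Sum using (inj₁; inj₂; [_,_])
open import Relation.Binary.Definitions using (tri<; tri≈; tri>)
open import Relation.Binary.PropositionalEquality using (_≢_; refl; sym; trans; cong; cong₂; subst; subst₂; module ≡-Reasoning)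
open import Relation.Nullary using (¬_; contradiction; yes; no)
open import Function.Bundles using (mk⇔; Equivalence)
open import Function.Base using (_∘_)
open import Function.Properties.Equivalence using () renaming (sym to ⇔-sym; trans to ⇔-trans)
open import Data.Product.Function.NonDependent.Propositional using (_×-⇔_)
import Data.Integer.Properties as ℤ
import Data.Integer.Tactic.RingSolver as ℤ-Solver
open import Data.Rational as ℚ using (ℚ; mkℚ)
import Data.Rational.Properties as ℚ
open import Data.Rational.Unnormalised as ℚᵘ using (ℚᵘ; mkℚᵘ; _≃_; *≡*)
import Data.Rational.Unnormalised.Properties as ℚᵘ

-- Squares, gcds and primes

square-injective : ∀ {m n} → m * m ≡ n * n → m ≡ n
square-injective {m} {n} eq with <-cmp m n
... | tri< m<n _ _ = contradiction eq (<⇒≢ (*-mono-< m<n m<n))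
... | tri≈ _ m≡n _ = m≡n
... | tri> _ _ n<m = contradiction (sym eq) (<⇒≢ (*-mono-< n<m n<m))

coprime-*ʳ : ∀ {m n o} → Coprime m n → Coprime m o → Coprime m (n * o)
coprime-*ʳ {m} {n} m⊥n m⊥o (d∣m , d∣no) = m⊥o (d∣m , coprime-divisor d⊥n d∣no)
  where
  d⊥n : Coprime _ n
  d⊥n (e∣d , e∣n) = m⊥n (∣-trans e∣d d∣m , e∣n)

coprime-square : ∀ {m n} → Coprime m n → Coprime (m * m) (n * n)
coprime-square m⊥n = coprime-*ʳ m*m⊥n m*m⊥n
  where
  m*m⊥n = Coprimality.sym (coprime-*ʳ (Coprimality.sym m⊥n) (Coprimality.sym m⊥n))

gcd[m*m,n*n]≡gcd[m,n]*gcd[m,n] : ∀ m n → gcd (m * m) (n * n) ≡ gcd m n * gcd m n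
gcd[m*m,n*n]≡gcd[m,n]*gcd[m,n] m n with gcd m n ≟ 0
... | yes g≡0 = begin
  gcd (m * m) (n * n)   ≡⟨ cong₂ (λ a b → gcd (a * a) (b * b))
                                 (gcd[m,n]≡0⇒m≡0 {m} {n} g≡0) (gcd[m,n]≡0⇒n≡0 m {n} g≡0) ⟩
  gcd 0 0               ≡⟨ gcd[0,0]≡0 ⟩
  0                     ≡⟨ cong (λ g → g * g) g≡0 ⟨
  gcd m n * gcd m n     ∎
  where open ≡-Reasoning
... | no g≢0 = begin
  gcd (m * m) (n * n)                           ≡⟨ cong₂ gcd (square-scaled (gcd[m,n]∣m m n)) (square-scaled (gcd[m,n]∣n m n)) ⟩
  gcd (g * g * (m′ * m′)) (g * g * (n′ * n′))   ≡⟨ c*gcd[m,n]≡gcd[cm,cn] (g * g) _ _ ⟨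
  g * g * gcd (m′ * m′) (n′ * n′)               ≡⟨ cong (g * g *_) (coprime⇒gcd≡1 (coprime-square (coprime-/gcd m n))) ⟩
  g * g * 1                                     ≡⟨ *-identityʳ (g * g) ⟩
  g * g                                         ∎
  where
  open ≡-Reasoning
  g = gcd m n
  instance _ = ≢-nonZero g≢0
  m′ = m / g
  n′ = n / g
  square-scaled : ∀ {k} → g ∣ k → k * k ≡ g * g * (k / g * (k / g))
  square-scaled {k} g∣k = begin
    k * k                       ≡⟨ cong (λ h → h * h) (m*[n/m]≡n g∣k) ⟨
    g * (k / g) * (g * (k / g)) ≡⟨ interchange g (k / g) g (k / g) ⟩
    g * g * (k / g * (k / g))   ∎

square∣square⇒∣ : ∀ {m n} → m * m ∣ n * n → m ∣ n
square∣square⇒∣ {m} {n} m²∣n² = subst (_∣ n) gcd[m,n]≡m (gcd[m,n]∣n m n)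
  where
  gcd[m,n]≡m : gcd m n ≡ m
  gcd[m,n]≡m = square-injective (trans (sym (gcd[m*m,n*n]≡gcd[m,n]*gcd[m,n] m n))
    (∣-antisym (gcd[m,n]∣m (m * m) (n * n)) (gcd-greatest ∣-refl m²∣n²)))

coprime-factor-of-square : ∀ {a b z} → Coprime a b → a * b ≡ z * z → a ≡ gcd a z * gcd a z
coprime-factor-of-square {a} {b} {z} a⊥b ab≡z² = begin
  a                     ≡⟨ *-identityʳ a ⟨
  a * 1                 ≡⟨ cong (a *_) (coprime⇒gcd≡1 a⊥b) ⟨
  a * gcd a b           ≡⟨ c*gcd[m,n]≡gcd[cm,cn] a a b ⟩
  gcd (a * a) (a * b)   ≡⟨ cong (gcd (a * a)) ab≡z² ⟩
  gcd (a * a) (z * z)   ≡⟨ gcd[m*m,n*n]≡gcd[m,n]*gcd[m,n] a z ⟩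
  gcd a z * gcd a z     ∎
  where open ≡-Reasoning

square-factors : ∀ {a b z} → a * b ≡ z * z → ∃₂ λ s t → a ≡ gcd a b * (s * s) × b ≡ gcd a b * (t * t)
square-factors {a} {b} {z} ab≡z² with gcd a b ≟ 0
... | yes g≡0 = 0 , 0 , trans (gcd[m,n]≡0⇒m≡0 g≡0) (sym (*-zeroʳ (gcd a b)))
                      , trans (gcd[m,n]≡0⇒n≡0 a g≡0) (sym (*-zeroʳ (gcd a b)))
... | no g≢0 = gcd a′ z′ , gcd b′ z′
             , trans (sym ga′≡a) (cong (g *_) (coprime-factor-of-square a′⊥b′ a′b′≡z′²))
             , trans (sym gb′≡b) (cong (g *_) (coprime-factor-of-square (Coprimality.sym a′⊥b′) b′a′≡z′²))
  where
  open ≡-Reasoning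
  g = gcd a b
  instance
    _ = ≢-nonZero g≢0
    _ = m*n≢0 g g
  a′ = a / g
  b′ = b / g
  a′⊥b′ : Coprime a′ b′
  a′⊥b′ = coprime-/gcd a b
  ga′≡a : g * a′ ≡ a
  ga′≡a = m*[n/m]≡n (gcd[m,n]∣m a b)
  gb′≡b : g * b′ ≡ b
  gb′≡b = m*[n/m]≡n (gcd[m,n]∣n a b)
  z²≡g²a′b′ : z * z ≡ g * g * (a′ * b′)
  z²≡g²a′b′ = begin
    z * z                 ≡⟨ ab≡z² ⟨
    a * b                 ≡⟨ cong₂ _*_ ga′≡a gb′≡b ⟨
    g * a′ * (g * b′)     ≡⟨ interchange g a′ g b′ ⟩
    g * g * (a′ * b′)     ∎
  g∣z : g ∣ z
  g∣z = square∣square⇒∣ (divides (a′ * b′) (trans z²≡g²a′b′ (*-comm (g * g) _)))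
  z′ = z / g
  a′b′≡z′² : a′ * b′ ≡ z′ * z′
  a′b′≡z′² = *-cancelˡ-≡ _ _ (g * g) (begin
    g * g * (a′ * b′)     ≡⟨ z²≡g²a′b′ ⟨
    z * z                 ≡⟨ cong (λ h → h * h) (m*[n/m]≡n g∣z) ⟨
    g * z′ * (g * z′)     ≡⟨ interchange g z′ g z′ ⟩
    g * g * (z′ * z′)     ∎)
  b′a′≡z′² : b′ * a′ ≡ z′ * z′
  b′a′≡z′² = trans (*-comm b′ a′) a′b′≡z′²

¬prime-square : ∀ n → ¬ Prime (n * n)
¬prime-square 0                = ¬prime[0]
¬prime-square 1                = ¬prime[1]
¬prime-square n@(suc (suc _)) n²-prime =
  prime⇒¬composite n²-prime (composite (m<m*n n n (s≤s (s≤s z≤n))) (divides n refl))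

prime+1≡square⇒≡3 : ∀ {p n} → Prime p → p + 1 ≡ n * n → p ≡ 3
prime+1≡square⇒≡3 {p} {0}             _       p+1≡0  = contradiction (m+n≡0⇒n≡0 p p+1≡0) λ ()
prime+1≡square⇒≡3 {p} {1}             p-prime p+1≡1  = contradiction (subst Prime (+-cancelʳ-≡ 1 p 0 p+1≡1) p-prime) ¬prime[0]
prime+1≡square⇒≡3 {p} {suc (suc k)} p-prime p+1≡n² =
  factorisation k (+-cancelʳ-≡ 1 p _ (trans p+1≡n² (square≡product+1 k))) p-prime
  where
  square≡product+1 : ∀ k → (2 + k) * (2 + k) ≡ (1 + k) * (3 + k) + 1
  square≡product+1 = solve-∀
  factorisation : ∀ {p} k → p ≡ (1 + k) * (3 + k) → Prime p → p ≡ 3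
  factorisation zero    p≡3  _       = p≡3
  factorisation (suc j) refl p-prime = contradiction
    (composite (m<m*n (2 + j) (4 + j) (s≤s (s≤s z≤n))) (divides (4 + j) (*-comm (2 + j) (4 + j))))
    (prime⇒¬composite p-prime)

square≡part*complement : ∀ {z a c} → z * z + a * a ≡ c * a → Σ ℕ λ b → a + b ≡ c × z * z ≡ a * b
square≡part*complement {z} {a} {c} eq with a ≤? c
... | yes a≤c = c ∸ a , m+[n∸m]≡n a≤c , +-cancelʳ-≡ (a * a) _ _ (begin
  z * z + a * a         ≡⟨ eq ⟩
  c * a                 ≡⟨ cong (_* a) (m+[n∸m]≡n a≤c) ⟨
  (a + (c ∸ a)) * a     ≡⟨ distrib a (c ∸ a) ⟩
  a * (c ∸ a) + a * a   ∎)
  where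
  open ≡-Reasoning
  distrib : ∀ a b → (a + b) * a ≡ a * b + a * a
  distrib = solve-∀
... | no a≰c = contradiction (sym eq) (<⇒≢ (<-≤-trans (*-monoˡ-< a c<a) (m≤n+m (a * a) (z * z))))
  where
  c<a = ≰⇒> a≰c
  instance _ = >-nonZero (≤-<-trans z≤n c<a)

-- The hypothesis says z² = (u − P)(Q − u); for P ≤ Q this forces P ≤ u ≤ Q.
roots-factorisation : ∀ {P Q u z} → P ≤ Q → z * z + u * u + P * Q ≡ (P + Q) * u →
                      ∃₂ λ a b → u ≡ P + a × u + b ≡ Q × z * z ≡ a * b
roots-factorisation {P} {Q} {u} {z} P≤Q eq with m≤n⇒∃[o]m+o≡n P≤Q | P ≤? u
... | c , refl | yes P≤u with m≤n⇒∃[o]m+o≡n P≤u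
...   | a , refl = a , b , refl , trans (+-assoc P a b) (cong (_+_ P) a+b≡c) , z²≡ab
  where
  shift : ∀ P a c z → z * z + (P + a) * (P + a) + P * (P + c) ≡ z * z + a * a + (2 * P * P + 2 * P * a + P * c)
  shift = solve-∀
  shift′ : ∀ P a c → (P + (P + c)) * (P + a) ≡ c * a + (2 * P * P + 2 * P * a + P * c)
  shift′ = solve-∀
  complement = square≡part*complement {z} {a} {c} (+-cancelʳ-≡ _ _ _ (trans (sym (shift P a c z)) (trans eq (shift′ P a c))))
  b = proj₁ complement
  a+b≡c = proj₁ (proj₂ complement)
  z²≡ab = proj₂ (proj₂ complement)
roots-factorisation {P} {Q} {u} {z} P≤Q eq | c , refl | no P≰u with m≤n⇒∃[o]m+o≡n (≰⇒> P≰u)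
... | k , refl =
  contradiction (m+n≡0⇒n≡0 (z * z) (+-cancelˡ-≡ _ _ 0 (trans (trans (excess u k c z) eq) (sym (+-identityʳ _))))) λ ()
  where
  excess : ∀ u k c z → (1 + u + k + (1 + u + k + c)) * u + (z * z + (1 + k) * (1 + k + c))
                       ≡ z * z + u * u + (1 + u + k) * (1 + u + k + c)
  excess = solve-∀

roots-product : ∀ {P Q u z a b} → u ≡ P + a → u + b ≡ Q → z * z ≡ a * b → z * z + u * u + P * Q ≡ (P + Q) * u
roots-product {P} {a = a} {b} refl refl z²≡ab rewrite z²≡ab = expand P a b
  where
  expand : ∀ P a b → a * b + (P + a) * (P + a) + P * (P + a + b) ≡ (P + (P + a + b)) * (P + a)
  expand = solve-∀

-- The homogenised curve and the systems (I), (II)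

-- The point (±n/d, ±z/d²) lies on C′; with u = n², P = pd², Q = qd² this reads z² = (u − P)(Q − u).
Homogeneous : ℕ → ℕ → ℕ → ℕ → ℕ → Set
Homogeneous p q n d z = z * z + n * n * (n * n) + p * (d * d) * (q * (d * d)) ≡ (p * (d * d) + q * (d * d)) * (n * n)

-- The point (±n/d, ±m/e) lies on C′, with denominators cleared.
CurveEq : ℕ → ℕ → ℕ → ℕ → ℕ → ℕ → Set
CurveEq p q n d m e = m * m * (d * d * (d * d)) + (n * n * (n * n) + p * q * (d * d * (d * d))) * (e * e)
                    ≡ (p + q) * (n * n) * (d * d) * (e * e)

curveEq⇒homogeneous : ∀ {p q n d m e} .{{_ : NonZero e}} → CurveEq p q n d m e → Σ ℕ λ z → Homogeneous p q n d z
curveEq⇒homogeneous {p} {q} {n} {d} {m} {e} eq = z , homogeneous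
  where
  open ≡-Reasoning
  U = n * n * (n * n) + p * q * (d * d * (d * d))
  V = (p + q) * (n * n) * (d * d)
  W = m * (d * d)
  instance _ = m*n≢0 e e
  W²+Ue²≡Ve² : W * W + U * (e * e) ≡ V * (e * e)
  W²+Ue²≡Ve² = trans (cong (_+ U * (e * e)) (interchange m (d * d) m (d * d))) eq
  e∣W : e ∣ W
  e∣W = square∣square⇒∣ (∣m+n∣m⇒∣n (subst (e * e ∣_) (trans (sym W²+Ue²≡Ve²) (+-comm (W * W) _)) (n∣m*n V))
                                    (n∣m*n U))
  z = W / e
  z²+U≡V : z * z + U ≡ V
  z²+U≡V = *-cancelʳ-≡ _ _ (e * e) (begin
    (z * z + U) * (e * e)         ≡⟨ expand e z U ⟩
    e * z * (e * z) + U * (e * e) ≡⟨ cong (λ w → w * w + U * (e * e)) (m*[n/m]≡n e∣W) ⟩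
    W * W + U * (e * e)           ≡⟨ W²+Ue²≡Ve² ⟩
    V * (e * e)                   ∎)
    where
    expand : ∀ e z U → (z * z + U) * (e * e) ≡ e * z * (e * z) + U * (e * e)
    expand = solve-∀
  homogeneous : Homogeneous p q n d z
  homogeneous = trans (regroup z n p q d) (trans z²+U≡V (distrib p q n d))
    where
    regroup : ∀ z n p q d → z * z + n * n * (n * n) + p * (d * d) * (q * (d * d))
                          ≡ z * z + (n * n * (n * n) + p * q * (d * d * (d * d)))
    regroup = solve-∀
    distrib : ∀ p q n d → (p + q) * (n * n) * (d * d) ≡ (p * (d * d) + q * (d * d)) * (n * n)
    distrib = solve-∀

homogeneous⇒curveEq : ∀ {p q n d z} → Homogeneous p q n d z → CurveEq p q n d z (d * d)
homogeneous⇒curveEq {p} {q} {n} {d} {z} eq =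
  trans (lhs z n p q d) (trans (cong (d * d * (d * d) *_) eq) (rhs n p q d))
  where
  lhs : ∀ z n p q d → z * z * (d * d * (d * d)) + (n * n * (n * n) + p * q * (d * d * (d * d))) * (d * d * (d * d))
                    ≡ d * d * (d * d) * (z * z + n * n * (n * n) + p * (d * d) * (q * (d * d)))
  lhs = solve-∀
  rhs : ∀ n p q d → d * d * (d * d) * ((p * (d * d) + q * (d * d)) * (n * n)) ≡ (p + q) * (n * n) * (d * d) * (d * d * (d * d))
  rhs = solve-∀

-- x² − py² = ks², x² − qy² = −kt²; k = 1 and k = 2 give the systems (I) and (II).
System : ℕ → ℕ → ℕ → ℕ → ℕ → ℕ → ℕ → Set
System k p q x y s t = x * x ≡ p * (y * y) + k * (s * s) × x * x + k * (t * t) ≡ q * (y * y)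

PrimitiveSolution : ℕ → ℕ → ℕ → Set
PrimitiveSolution k p q = Σ ℕ λ x → Σ ℕ λ y → Σ ℕ λ s → Σ ℕ λ t → gcd x y ≡ 1 × System k p q x y s t

homogeneous⇒system : ∀ {p q n d z} → p ≤ q → Homogeneous p q n d z → Σ ℕ λ k → ∃₂ λ s t → System k p q n d s t
homogeneous⇒system {p} {q} {n} {d} {z} p≤q eq
  with roots-factorisation {p * (d * d)} {q * (d * d)} {n * n} {z} (*-monoˡ-≤ (d * d) p≤q) eq
... | a , b , n²≡P+a , n²+b≡Q , z²≡ab with square-factors {a} {b} {z} (sym z²≡ab)
...   | s , t , a≡ks² , b≡kt² =
  gcd a b , s , t , trans n²≡P+a (cong (_+_ _) a≡ks²) , trans (cong (_+_ _) (sym b≡kt²)) n²+b≡Q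

system⇒homogeneous : ∀ {k p q x y s t} → System k p q x y s t → Homogeneous p q x y (k * (s * t))
system⇒homogeneous {k} {p} {q} {x} {y} {s} {t} (x²≡P+ks² , x²+kt²≡Q) =
  roots-product {p * (y * y)} {q * (y * y)} {x * x} {k * (s * t)} x²≡P+ks² x²+kt²≡Q (square-split k s t)
  where
  square-split : ∀ k s t → k * (s * t) * (k * (s * t)) ≡ k * (s * s) * (k * (t * t))
  square-split = solve-∀

system-scale∣2 : ∀ {k p x y s t} → Coprime x y → System k p (p + 2) x y s t → k ∣ 2
system-scale∣2 {k} {p} {x} {y} {s} {t} x⊥y (x²≡py²+ks² , x²+kt²≡qy²) =
  subst (k ∣_) gcd[2x²,2y²]≡2 (gcd-greatest k∣2x² (divides-by-k 2y²≡k[s²+t²]))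
  where
  open ≡-Reasoning
  divides-by-k : ∀ {m c} → m ≡ k * c → k ∣ m
  divides-by-k {m} {c} m≡kc = divides c (trans m≡kc (*-comm k c))
  2y²≡k[s²+t²] : 2 * (y * y) ≡ k * (s * s + t * t)
  2y²≡k[s²+t²] = +-cancelˡ-≡ (p * (y * y)) _ _ (begin
    p * (y * y) + 2 * (y * y)             ≡⟨ *-distribʳ-+ (y * y) p 2 ⟨
    (p + 2) * (y * y)                     ≡⟨ x²+kt²≡qy² ⟨
    x * x + k * (t * t)                   ≡⟨ cong (_+ k * (t * t)) x²≡py²+ks² ⟩
    p * (y * y) + k * (s * s) + k * (t * t) ≡⟨ +-assoc (p * (y * y)) _ _ ⟩
    p * (y * y) + (k * (s * s) + k * (t * t)) ≡⟨ cong (_+_ (p * (y * y))) (*-distribˡ-+ k (s * s) (t * t)) ⟨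
    p * (y * y) + k * (s * s + t * t)     ∎)
  k∣2x² : k ∣ 2 * (x * x)
  k∣2x² = divides-by-k (begin
    2 * (x * x)                           ≡⟨ cong (2 *_) x²≡py²+ks² ⟩
    2 * (p * (y * y) + k * (s * s))       ≡⟨ regroup p (y * y) k (s * s) ⟩
    p * (2 * (y * y)) + 2 * (k * (s * s)) ≡⟨ cong (λ w → p * w + 2 * (k * (s * s))) 2y²≡k[s²+t²] ⟩
    p * (k * (s * s + t * t)) + 2 * (k * (s * s)) ≡⟨ factor p k (s * s) (t * t) ⟩
    k * (p * (s * s + t * t) + 2 * (s * s)) ∎)
    where
    regroup : ∀ p y² k s² → 2 * (p * y² + k * s²) ≡ p * (2 * y²) + 2 * (k * s²)
    regroup = solve-∀
    factor : ∀ p k s² t² → p * (k * (s² + t²)) + 2 * (k * s²) ≡ k * (p * (s² + t²) + 2 * s²)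
    factor = solve-∀
  gcd[2x²,2y²]≡2 : gcd (2 * (x * x)) (2 * (y * y)) ≡ 2
  gcd[2x²,2y²]≡2 = begin
    gcd (2 * (x * x)) (2 * (y * y))       ≡⟨ c*gcd[m,n]≡gcd[cm,cn] 2 (x * x) (y * y) ⟨
    2 * gcd (x * x) (y * y)               ≡⟨ cong (2 *_) (gcd[m*m,n*n]≡gcd[m,n]*gcd[m,n] x y) ⟩
    2 * (gcd x y * gcd x y)               ≡⟨ cong (λ g → 2 * (g * g)) (coprime⇒gcd≡1 x⊥y) ⟩
    2                                     ∎

system-÷ : ∀ {k p q g x y s t x′ y′ s′ t′} .{{_ : NonZero g}} →
           g * x′ ≡ x → g * y′ ≡ y → g * s′ ≡ s → g * t′ ≡ t →
           System k p q x y s t → System k p q x′ y′ s′ t′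
system-÷ {k} {p} {q} {g} {x′ = x′} {y′} {s′} {t′} refl refl refl refl (x²≡py²+ks² , x²+kt²≡qy²) =
    *-cancelˡ-≡ _ _ (g * g) (trans (sym (interchange g x′ g x′)) (trans x²≡py²+ks² (rhs₁ g p y′ k s′)))
  , *-cancelˡ-≡ _ _ (g * g) (trans (sym (lhs₂ g x′ k t′)) (trans x²+kt²≡qy² (rhs₂ g q y′)))
  where
  instance _ = m*n≢0 g g
  rhs₁ : ∀ g p y k s → p * (g * y * (g * y)) + k * (g * s * (g * s)) ≡ g * g * (p * (y * y) + k * (s * s))
  rhs₁ = solve-∀
  lhs₂ : ∀ g x k t → g * x * (g * x) + k * (g * t * (g * t)) ≡ g * g * (x * x + k * (t * t))
  lhs₂ = solve-∀
  rhs₂ : ∀ g q y → q * (g * y * (g * y)) ≡ g * g * (q * (y * y))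
  rhs₂ = solve-∀

system⇒primitive-solution : ∀ {p q x y s t} .{{_ : NonZero y}} → System 1 p q x y s t → PrimitiveSolution 1 p q
system⇒primitive-solution {p} {q} {x} {y} {s} {t} system@(x²≡py²+s² , x²+t²≡qy²) =
  x / g , y / g , s / g , t / g , coprime⇒gcd≡1 (coprime-/gcd x y) ,
  system-÷ {1} {p} {q} {g} (m*[n/m]≡n g∣x) (m*[n/m]≡n g∣y) (m*[n/m]≡n g∣s) (m*[n/m]≡n g∣t) system
  where
  g = gcd x y
  instance _ = ≢-nonZero (gcd[m,n]≢0 x y (inj₂ (≢-nonZero⁻¹ y)))
  g∣x = gcd[m,n]∣m x y
  g∣y = gcd[m,n]∣n x y
  g²∣x² = *-pres-∣ g∣x g∣x
  g²∣y² = *-pres-∣ g∣y g∣y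
  g∣s : g ∣ s
  g∣s = square∣square⇒∣ (subst (g * g ∣_) (*-identityˡ (s * s))
          (∣m+n∣m⇒∣n (subst (g * g ∣_) x²≡py²+s² g²∣x²) (∣n⇒∣m*n p g²∣y²)))
  g∣t : g ∣ t
  g∣t = square∣square⇒∣ (subst (g * g ∣_) (*-identityˡ (t * t))
          (∣m+n∣m⇒∣n (subst (g * g ∣_) (sym x²+t²≡qy²) (∣n⇒∣m*n q g²∣y²)) g²∣x²))

primitive-solution⇒y≢0 : ∀ {k p q x s t} → gcd x 0 ≡ 1 → ¬ System k p q x 0 s t
primitive-solution⇒y≢0 {k} {p} {q} {x} {s} {t} gcd≡1 (_ , x²+kt²≡0) with trans (sym (gcd-identityʳ x)) gcd≡1
... | refl = contradiction (trans x²+kt²≡0 (*-zeroʳ q)) λ ()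

integral-homogeneous⇒p≡3 : ∀ {p n z} → Prime p → Prime (p + 2) → Homogeneous p (p + 2) n 1 z → p ≡ 3
integral-homogeneous⇒p≡3 {p} {n} {z} p-prime q-prime eq
  with roots-factorisation {p * 1} {(p + 2) * 1} {n * n} {z} (*-monoˡ-≤ 1 (m≤m+n p 2)) eq
... | a , b , n²≡p+a , n²+b≡p+2 , _ = classify a b (trans n²≡p+a (cong (_+ a) (*-identityʳ p))) a+b≡2
  where
  open ≡-Reasoning
  a+b≡2 : a + b ≡ 2
  a+b≡2 = +-cancelˡ-≡ p _ _ (begin
    p + (a + b)    ≡⟨ +-assoc p a b ⟨
    p + a + b      ≡⟨ cong (λ m → m + a + b) (*-identityʳ p) ⟨
    p * 1 + a + b  ≡⟨ cong (_+ b) n²≡p+a ⟨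
    n * n + b      ≡⟨ n²+b≡p+2 ⟩
    (p + 2) * 1    ≡⟨ *-identityʳ (p + 2) ⟩
    p + 2          ∎)
  classify : ∀ a b → n * n ≡ p + a → a + b ≡ 2 → p ≡ 3
  classify 0 _ n²≡p+0 _ = contradiction (subst Prime (trans (sym (+-identityʳ p)) (sym n²≡p+0)) p-prime) (¬prime-square n)
  classify 1 _ n²≡p+1 _ = prime+1≡square⇒≡3 {p} {n} p-prime (sym n²≡p+1)
  classify 2 _ n²≡p+2 _ = contradiction (subst Prime (sym n²≡p+2) q-prime) (¬prime-square n)
  classify (suc (suc (suc _))) _ _ ()

-- Transfer between ℤ and ℕ

≡⇔≡ : ∀ {A : Set} {a a′ b b′ : A} → a ≡ a′ → b ≡ b′ → (a ≡ b) ⇔ (a′ ≡ b′)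
≡⇔≡ refl refl = mk⇔ (λ eq → eq) (λ eq → eq)

square-abs : ∀ i → i ℤ.* i ≡ + (ℤ.∣ i ∣ * ℤ.∣ i ∣)
square-abs (+ n)    = sym (ℤ.pos-* n n)
square-abs -[1+ n ] = refl

scaled-square-abs : ∀ c i → + c ℤ.* (i ℤ.* i) ≡ + (c * (ℤ.∣ i ∣ * ℤ.∣ i ∣))
scaled-square-abs c i = trans (cong (ℤ._*_ (+ c)) (square-abs i)) (sym (ℤ.pos-* c _))

pos-difference⇔ : ∀ {a b c} → + a ℤ.- + b ≡ + c ⇔ a ≡ b + c
pos-difference⇔ {a} {b} {c} = mk⇔
  (λ eq → ℤ.+-injective (trans (split (+ a) (+ b)) (cong (ℤ._+_ (+ b)) eq)))
  (λ { refl → cancel (+ b) (+ c) })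
  where
  split : ∀ i j → i ≡ j ℤ.+ (i ℤ.- j)
  split = ℤ-Solver.solve-∀
  cancel : ∀ j k → j ℤ.+ k ℤ.- j ≡ k
  cancel = ℤ-Solver.solve-∀

pos-difference≡neg⇔ : ∀ {a b c} → + a ℤ.- + b ≡ ℤ.- + c ⇔ a + c ≡ b
pos-difference≡neg⇔ {a} {b} {c} = mk⇔
  (λ eq → ℤ.+-injective (trans (cong (ℤ._+ + c) (split (+ a) (+ b)))
                        (trans (cong (λ d → + b ℤ.+ d ℤ.+ + c) eq) (cancel (+ b) (+ c)))))
  (λ { refl → cancel′ (+ a) (+ c) })
  where
  split : ∀ i j → i ≡ j ℤ.+ (i ℤ.- j)
  split = ℤ-Solver.solve-∀
  cancel : ∀ j k → j ℤ.+ ℤ.- k ℤ.+ k ≡ j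
  cancel = ℤ-Solver.solve-∀
  cancel′ : ∀ i k → i ℤ.- (i ℤ.+ k) ≡ ℤ.- k
  cancel′ = ℤ-Solver.solve-∀

-- SystemII p q is Systemℤ 2 p q by definition; SystemI p q differs from Systemℤ 1 p q by the factors + 1.
Systemℤ : ℕ → ℕ → ℕ → ℤ → ℤ → ℤ → ℤ → Set
Systemℤ k p q X Y S T = (X ℤ.* X ℤ.- + p ℤ.* (Y ℤ.* Y) ≡ + k ℤ.* (S ℤ.* S))
                      × (X ℤ.* X ℤ.- + q ℤ.* (Y ℤ.* Y) ≡ ℤ.- (+ k ℤ.* (T ℤ.* T)))

Systemℤ⇔System : ∀ {k p q} X Y S T →
                 Systemℤ k p q X Y S T ⇔ System k p q ℤ.∣ X ∣ ℤ.∣ Y ∣ ℤ.∣ S ∣ ℤ.∣ T ∣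
Systemℤ⇔System {k} {p} {q} X Y S T =
      ⇔-trans (≡⇔≡ (cong₂ ℤ._-_ (square-abs X) (scaled-square-abs p Y)) (scaled-square-abs k S))
              pos-difference⇔
  ×-⇔ ⇔-trans (≡⇔≡ (cong₂ ℤ._-_ (square-abs X) (scaled-square-abs q Y)) (cong ℤ.-_ (scaled-square-abs k T)))
              pos-difference≡neg⇔

SystemI⇔Systemℤ : ∀ {p q} X Y S T → SystemI p q X Y S T ⇔ Systemℤ 1 p q X Y S T
SystemI⇔Systemℤ X Y S T =
  ≡⇔≡ refl (sym (ℤ.*-identityˡ (S ℤ.* S))) ×-⇔ ≡⇔≡ refl (cong ℤ.-_ (sym (ℤ.*-identityˡ (T ℤ.* T))))

SystemI⇔System : ∀ {p q} X Y S T → SystemI p q X Y S T ⇔ System 1 p q ℤ.∣ X ∣ ℤ.∣ Y ∣ ℤ.∣ S ∣ ℤ.∣ T ∣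
SystemI⇔System {p} {q} X Y S T = ⇔-trans (SystemI⇔Systemℤ {p} {q} X Y S T) (Systemℤ⇔System {1} {p} {q} X Y S T)

primary⇔primitive : ∀ {k p q} {Sys : ℤ → ℤ → ℤ → ℤ → Set} →
                    (∀ X Y S T → Sys X Y S T ⇔ System k p q ℤ.∣ X ∣ ℤ.∣ Y ∣ ℤ.∣ S ∣ ℤ.∣ T ∣) →
                    HasPrimarySolution Sys ⇔ PrimitiveSolution k p q
primary⇔primitive Sys⇔System = mk⇔
  (λ (X , Y , S , T , gcd≡1 , sys) → ℤ.∣ X ∣ , ℤ.∣ Y ∣ , ℤ.∣ S ∣ , ℤ.∣ T ∣ , ℤ.+-injective gcd≡1
                                    , Equivalence.to (Sys⇔System X Y S T) sys)
  (λ (x , y , s , t , gcd≡1 , sys) → + x , + y , + s , + t , cong (λ k → + k) gcd≡1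
                                    , Equivalence.from (Sys⇔System (+ x) (+ y) (+ s) (+ t)) sys)

primaryI⇔primitive : ∀ {p q} → HasPrimarySolution (SystemI p q) ⇔ PrimitiveSolution 1 p q
primaryI⇔primitive {p} {q} = primary⇔primitive {1} {p} {q} {SystemI p q} (SystemI⇔System {p} {q})

primaryII⇔primitive : ∀ {p q} → HasPrimarySolution (SystemII p q) ⇔ PrimitiveSolution 2 p q
primaryII⇔primitive {p} {q} = primary⇔primitive {2} {p} {q} {SystemII p q} (Systemℤ⇔System {2} {p} {q})

CurveEqℤ : ℕ → ℕ → ℤ → ℤ → ℤ → ℤ → Set
CurveEqℤ p q N D M E =
  M ℤ.* M ℤ.* (D ℤ.* D ℤ.* (D ℤ.* D))
    ℤ.+ (N ℤ.* N ℤ.* (N ℤ.* N) ℤ.+ + (p * q) ℤ.* (D ℤ.* D ℤ.* (D ℤ.* D))) ℤ.* (E ℤ.* E)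
  ≡ + (p + q) ℤ.* (N ℤ.* N) ℤ.* (D ℤ.* D) ℤ.* (E ℤ.* E)

CurveEqℤ⇔CurveEq : ∀ {p q} N D M E → CurveEqℤ p q N D M E ⇔ CurveEq p q ℤ.∣ N ∣ ℤ.∣ D ∣ ℤ.∣ M ∣ ℤ.∣ E ∣
CurveEqℤ⇔CurveEq {p} {q} N D M E
  rewrite square-abs N | square-abs D | square-abs M | square-abs E =
  ⇔-trans (≡⇔≡ (sym (pos-lhs ∣M∣² ∣N∣² ∣D∣² ∣E∣²)) (sym (pos-rhs ∣N∣² ∣D∣² ∣E∣²)))
          (mk⇔ ℤ.+-injective (cong λ k → + k))
  where
  ∣M∣² = ℤ.∣ M ∣ * ℤ.∣ M ∣
  ∣N∣² = ℤ.∣ N ∣ * ℤ.∣ N ∣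
  ∣D∣² = ℤ.∣ D ∣ * ℤ.∣ D ∣
  ∣E∣² = ℤ.∣ E ∣ * ℤ.∣ E ∣
  pos-lhs : ∀ m² n² d² e² → + (m² * (d² * d²) + (n² * n² + p * q * (d² * d²)) * e²)
          ≡ + m² ℤ.* (+ d² ℤ.* + d²) ℤ.+ (+ n² ℤ.* + n² ℤ.+ + (p * q) ℤ.* (+ d² ℤ.* + d²)) ℤ.* + e²
  pos-lhs m² n² d² e² = cong₂ ℤ._+_
    (trans (ℤ.pos-* m² (d² * d²)) (cong (ℤ._*_ (+ m²)) (ℤ.pos-* d² d²)))
    (trans (ℤ.pos-* (n² * n² + p * q * (d² * d²)) e²) (cong (ℤ._* + e²) (cong₂ ℤ._+_ (ℤ.pos-* n² n²)
      (trans (ℤ.pos-* (p * q) (d² * d²)) (cong (ℤ._*_ (+ (p * q))) (ℤ.pos-* d² d²))))))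
  pos-rhs : ∀ n² d² e² → + ((p + q) * n² * d² * e²) ≡ + (p + q) ℤ.* + n² ℤ.* + d² ℤ.* + e²
  pos-rhs n² d² e² = trans (ℤ.pos-* ((p + q) * n² * d²) e²) (cong (ℤ._* + e²)
    (trans (ℤ.pos-* ((p + q) * n²) d²) (cong (ℤ._* + d²) (ℤ.pos-* (p + q) n²))))

onCurveℤ⇒CurveEqℤ : ∀ {p q x y} → OnCurveℤ p q x y → CurveEqℤ p q x (+ 1) y (+ 1)
onCurveℤ⇒CurveEqℤ {p} {q} {x} {y} eq = begin
  y ℤ.* y ℤ.* + 1 ℤ.+ (x ℤ.* x ℤ.* (x ℤ.* x) ℤ.+ B ℤ.* + 1) ℤ.* + 1 ≡⟨ drop-ones y x B ⟩
  y ℤ.* y ℤ.+ (x ℤ.* x ℤ.* (x ℤ.* x) ℤ.+ B)                         ≡⟨ cong (ℤ._+ (x ℤ.* x ℤ.* (x ℤ.* x) ℤ.+ B)) eq ⟩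
  quartic x ℤ.+ (x ℤ.* x ℤ.* (x ℤ.* x) ℤ.+ B)                       ≡⟨ cancel x A B ⟩
  A ℤ.* (x ℤ.* x) ℤ.* + 1 ℤ.* + 1                                   ∎
  where
  open ≡-Reasoning
  A = + (p + q)
  B = + (p * q)
  quartic : ℤ → ℤ
  quartic x = ℤ.- (x ℤ.* x ℤ.* x ℤ.* x) ℤ.+ A ℤ.* (x ℤ.* x) ℤ.- B
  drop-ones : ∀ y x B → y ℤ.* y ℤ.* + 1 ℤ.+ (x ℤ.* x ℤ.* (x ℤ.* x) ℤ.+ B ℤ.* + 1) ℤ.* + 1
                      ≡ y ℤ.* y ℤ.+ (x ℤ.* x ℤ.* (x ℤ.* x) ℤ.+ B)
  drop-ones = ℤ-Solver.solve-∀
  cancel : ∀ x A B → ℤ.- (x ℤ.* x ℤ.* x ℤ.* x) ℤ.+ A ℤ.* (x ℤ.* x) ℤ.- B ℤ.+ (x ℤ.* x ℤ.* (x ℤ.* x) ℤ.+ B)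
                   ≡ A ℤ.* (x ℤ.* x) ℤ.* + 1 ℤ.* + 1
  cancel = ℤ-Solver.solve-∀

-- Rational points

quarticℚ : ℕ → ℕ → ℚ → ℚ
quarticℚ p q x = (ℚ.- (x ℚ.* x ℚ.* x ℚ.* x)) ℚ.+ ℕtoℚ (p + q) ℚ.* (x ℚ.* x) ℚ.- ℕtoℚ (p * q)

quarticᵘ : ℕ → ℕ → ℚᵘ → ℚᵘ
quarticᵘ p q X =
  (ℚᵘ.- (X ℚᵘ.* X ℚᵘ.* X ℚᵘ.* X)) ℚᵘ.+ mkℚᵘ (+ (p + q)) 0 ℚᵘ.* (X ℚᵘ.* X) ℚᵘ.- mkℚᵘ (+ (p * q)) 0

quarticᵘ-cong : ∀ {p q X X′} → X ≃ X′ → quarticᵘ p q X ≃ quarticᵘ p q X′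
quarticᵘ-cong {p} {q} X≃X′ =
  ℚᵘ.+-congˡ _ (ℚᵘ.+-cong (ℚᵘ.-‿cong X⁴≃X′⁴) (ℚᵘ.*-congˡ {mkℚᵘ (+ (p + q)) 0} X²≃X′²))
  where
  X²≃X′² = ℚᵘ.*-cong X≃X′ X≃X′
  X⁴≃X′⁴ = ℚᵘ.*-cong (ℚᵘ.*-cong X²≃X′² X≃X′) X≃X′

toℚᵘ-ℕtoℚ : ∀ n → ℚ.toℚᵘ (ℕtoℚ n) ≃ mkℚᵘ (+ n) 0
toℚᵘ-ℕtoℚ n = ℚ.toℚᵘ-fromℚᵘ (mkℚᵘ (+ n) 0)

toℚᵘ-quartic : ∀ p q x → ℚ.toℚᵘ (quarticℚ p q x) ≃ quarticᵘ p q (ℚ.toℚᵘ x)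
toℚᵘ-quartic p q x =
  ℚᵘ.≃-trans (ℚ.toℚᵘ-homo-+ (ℚ.- x⁴ ℚ.+ ℕtoℚ (p + q) ℚ.* x²) (ℚ.- ℕtoℚ (p * q)))
    (ℚᵘ.+-cong (ℚᵘ.≃-trans (ℚ.toℚᵘ-homo-+ (ℚ.- x⁴) (ℕtoℚ (p + q) ℚ.* x²))
                           (ℚᵘ.+-cong quartic-term quadratic-term))
               constant-term)
  where
  X = ℚ.toℚᵘ x
  x² = x ℚ.* x
  x⁴ = x ℚ.* x ℚ.* x ℚ.* x
  [x²] : ℚ.toℚᵘ x² ≃ X ℚᵘ.* X
  [x²] = ℚ.toℚᵘ-homo-* x x
  [x⁴] : ℚ.toℚᵘ x⁴ ≃ X ℚᵘ.* X ℚᵘ.* X ℚᵘ.* X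
  [x⁴] = ℚᵘ.≃-trans (ℚ.toℚᵘ-homo-* (x² ℚ.* x) x)
           (ℚᵘ.*-congʳ (ℚᵘ.≃-trans (ℚ.toℚᵘ-homo-* x² x) (ℚᵘ.*-congʳ [x²])))
  quartic-term : ℚ.toℚᵘ (ℚ.- x⁴) ≃ ℚᵘ.- (X ℚᵘ.* X ℚᵘ.* X ℚᵘ.* X)
  quartic-term = ℚᵘ.≃-trans (ℚ.toℚᵘ-homo‿- x⁴) (ℚᵘ.-‿cong [x⁴])
  quadratic-term : ℚ.toℚᵘ (ℕtoℚ (p + q) ℚ.* x²) ≃ mkℚᵘ (+ (p + q)) 0 ℚᵘ.* (X ℚᵘ.* X)
  quadratic-term = ℚᵘ.≃-trans (ℚ.toℚᵘ-homo-* (ℕtoℚ (p + q)) x²) (ℚᵘ.*-cong (toℚᵘ-ℕtoℚ (p + q)) [x²])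
  constant-term : ℚ.toℚᵘ (ℚ.- ℕtoℚ (p * q)) ≃ ℚᵘ.- mkℚᵘ (+ (p * q)) 0
  constant-term = ℚᵘ.≃-trans (ℚ.toℚᵘ-homo‿- (ℕtoℚ (p * q))) (ℚᵘ.-‿cong (toℚᵘ-ℕtoℚ (p * q)))

onCurveℚ⇔ᵘ : ∀ {p q} x y → OnCurveℚ p q x y ⇔ (ℚ.toℚᵘ y ℚᵘ.* ℚ.toℚᵘ y ≃ quarticᵘ p q (ℚ.toℚᵘ x))
onCurveℚ⇔ᵘ {p} {q} x y = mk⇔
  (λ eq → ℚᵘ.≃-trans (ℚᵘ.≃-sym (ℚ.toℚᵘ-homo-* y y)) (ℚᵘ.≃-trans (ℚ.toℚᵘ-cong eq) (toℚᵘ-quartic p q x)))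
  (λ eq → ℚ.toℚᵘ-injective
            (ℚᵘ.≃-trans (ℚ.toℚᵘ-homo-* y y) (ℚᵘ.≃-trans eq (ℚᵘ.≃-sym (toℚᵘ-quartic p q x)))))

≡⇔difference≡0 : ∀ {i j} → (i ≡ j) ⇔ (i ℤ.- j ≡ + 0)
≡⇔difference≡0 {i} {j} = mk⇔ ℤ.i≡j⇒i-j≡0 (ℤ.i-j≡0⇒i≡j i j)

*-cancelˡ⇔ : ∀ {i j} k .{{_ : ℤ.NonZero k}} → (k ℤ.* i ≡ k ℤ.* j) ⇔ (i ≡ j)
*-cancelˡ⇔ {i} {j} k = mk⇔ (ℤ.*-cancelˡ-≡ k i j) (cong (ℤ._*_ k))

onCurveᵘ⇔CurveEqℤ : ∀ {p q} N k M j →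
  (mkℚᵘ M j ℚᵘ.* mkℚᵘ M j ≃ quarticᵘ p q (mkℚᵘ N k)) ⇔ CurveEqℤ p q N (+ suc k) M (+ suc j)
onCurveᵘ⇔CurveEqℤ {p} {q} N k M j =
  ⇔-trans (mk⇔ ℚᵘ.drop-*≡* *≡*) (
  ⇔-trans ≡⇔difference≡0 (
  ⇔-trans (≡⇔≡ (cross-difference M N (+ suc k) (+ suc j) (+ (p + q)) (+ (p * q))) refl) (
  ⇔-trans (⇔-sym ≡⇔difference≡0)
          (*-cancelˡ⇔ (+ suc k ℤ.* + suc k)))))
  where
  -- For X = N/D and Y = M/E the left-hand side is ↥ (Y * Y) * ↧ (quarticᵘ p q X) − ↥ (quarticᵘ p q X) * ↧ (Y * Y),
  -- written exactly as ℚᵘ arithmetic computes it.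
  cross-difference : ∀ M N D E A B →
      M ℤ.* M ℤ.* (D ℤ.* D ℤ.* D ℤ.* D ℤ.* (+ 1 ℤ.* (D ℤ.* D)) ℤ.* + 1)
    ℤ.- ((ℤ.- (N ℤ.* N ℤ.* N ℤ.* N) ℤ.* (+ 1 ℤ.* (D ℤ.* D))
          ℤ.+ A ℤ.* (N ℤ.* N) ℤ.* (D ℤ.* D ℤ.* D ℤ.* D)) ℤ.* + 1
         ℤ.+ ℤ.- B ℤ.* (D ℤ.* D ℤ.* D ℤ.* D ℤ.* (+ 1 ℤ.* (D ℤ.* D)))) ℤ.* (E ℤ.* E)
    ≡ D ℤ.* D ℤ.* (M ℤ.* M ℤ.* (D ℤ.* D ℤ.* (D ℤ.* D))
                   ℤ.+ (N ℤ.* N ℤ.* (N ℤ.* N) ℤ.+ B ℤ.* (D ℤ.* D ℤ.* (D ℤ.* D))) ℤ.* (E ℤ.* E))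
      ℤ.- D ℤ.* D ℤ.* (A ℤ.* (N ℤ.* N) ℤ.* (D ℤ.* D) ℤ.* (E ℤ.* E))
  cross-difference = ℤ-Solver.solve-∀

-- Parts (i) and (ii)

integer-point⇒homogeneous : ∀ {p q} → HasIntegerPoint p q → Σ ℕ λ n → Σ ℕ λ z → Homogeneous p q n 1 z
integer-point⇒homogeneous {p} {q} (x , y , eq) =
  ℤ.∣ x ∣ , curveEq⇒homogeneous {p} {q} {ℤ.∣ x ∣} {1} {ℤ.∣ y ∣} {1}
              (Equivalence.to (CurveEqℤ⇔CurveEq {p} {q} x (+ 1) y (+ 1)) (onCurveℤ⇒CurveEqℤ {p} {q} {x} {y} eq))

rational-point⇒homogeneous : ∀ {p q} → HasRationalPoint p q →
                             Σ ℕ λ n → Σ ℕ λ d → Coprime n d × Σ ℕ λ z → Homogeneous p q n d z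
rational-point⇒homogeneous {p} {q} (x@(mkℚ N k N⊥d) , y@(mkℚ M j _) , eq) =
  ℤ.∣ N ∣ , suc k , Coprimality.recompute N⊥d ,
  curveEq⇒homogeneous {p} {q} {ℤ.∣ N ∣} {suc k} {ℤ.∣ M ∣} {suc j}
    (Equivalence.to (CurveEqℤ⇔CurveEq {p} {q} N (+ suc k) M (+ suc j))
      (Equivalence.to (onCurveᵘ⇔CurveEqℤ {p} {q} N k M j)
        (Equivalence.to (onCurveℚ⇔ᵘ {p} {q} x y) eq)))

homogeneous⇒rational-point : ∀ {p q n d z} .{{_ : NonZero d}} → Homogeneous p q n d z → HasRationalPoint p q
homogeneous⇒rational-point {p} {q} {n} {d@(suc k)} {z} eq = x , y , Equivalence.from (onCurveℚ⇔ᵘ {p} {q} x y) (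
  ℚᵘ.≃-trans (ℚᵘ.*-cong (ℚ.toℚᵘ-fromℚᵘ Y) (ℚ.toℚᵘ-fromℚᵘ Y)) (
  ℚᵘ.≃-trans Y²≃quartic[X]
             (quarticᵘ-cong {p} {q} (ℚᵘ.≃-sym (ℚ.toℚᵘ-fromℚᵘ X)))))
  where
  -- mkℚᵘ takes the denominator minus one, and d * d reduces to suc (k + k * d): X = n/d and Y = z/d².
  X = mkℚᵘ (+ n) k
  Y = mkℚᵘ (+ z) (k + k * d)
  x = ℚ.fromℚᵘ X
  y = ℚ.fromℚᵘ Y
  Y²≃quartic[X] : Y ℚᵘ.* Y ≃ quarticᵘ p q X
  Y²≃quartic[X] = Equivalence.from (onCurveᵘ⇔CurveEqℤ {p} {q} (+ n) k (+ z) (k + k * d))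
    (Equivalence.from (CurveEqℤ⇔CurveEq {p} {q} (+ n) (+ d) (+ z) (+ (d * d))) (homogeneous⇒curveEq {p} {q} {n} {d} {z} eq))

rational-point⇒primitive-solution : ∀ {p} → HasRationalPoint p (p + 2) →
                                    PrimitiveSolution 1 p (p + 2) ⊎ PrimitiveSolution 2 p (p + 2)
rational-point⇒primitive-solution {p} point =
  let n , d , n⊥d , z , eq = rational-point⇒homogeneous {p} {p + 2} point
      k , s , t , system   = homogeneous⇒system {p} {p + 2} {n} {d} {z} (m≤m+n p 2) eq
  in by-scale (irreducible[2] (system-scale∣2 {k} {p} {n} {d} {s} {t} n⊥d system))
              (n , d , s , t , coprime⇒gcd≡1 n⊥d , system)
  where
  by-scale : ∀ {k} → k ≡ 1 ⊎ k ≡ 2 → PrimitiveSolution k p (p + 2) →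
             PrimitiveSolution 1 p (p + 2) ⊎ PrimitiveSolution 2 p (p + 2)
  by-scale (inj₁ refl) = inj₁
  by-scale (inj₂ refl) = inj₂

primitive-solution⇒rational-point : ∀ {k p q} → PrimitiveSolution k p q → HasRationalPoint p q
primitive-solution⇒rational-point {k} {p} {q} (x , 0 , s , t , gcd≡1 , system) =
  contradiction system (primitive-solution⇒y≢0 {k} {p} {q} {x} {s} {t} gcd≡1)
primitive-solution⇒rational-point {k} {p} {q} (x , y@(suc _) , s , t , _ , system) =
  homogeneous⇒rational-point {p} {q} {x} {y} {k * (s * t)} (system⇒homogeneous {k} {p} {q} {x} {y} {s} {t} system)

integer-points : ∀ {p} → Prime p → Prime (p + 2) → HasIntegerPoint p (p + 2) ⇔ (p ≡ 3)
integer-points {p} p-prime q-prime = mk⇔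
  (λ point → let n , z , eq = integer-point⇒homogeneous {p} {p + 2} point
             in integral-homogeneous⇒p≡3 {p} {n} {z} p-prime q-prime eq)
  (λ { refl → + 2 , + 1 , refl })

rational-points : ∀ {p} → HasRationalPoint p (p + 2) ⇔
                  (HasPrimarySolution (SystemI p (p + 2)) ⊎ HasPrimarySolution (SystemII p (p + 2)))
rational-points {p} = mk⇔
  (Sum.map (Equivalence.from I⇔1) (Equivalence.from II⇔2) ∘ rational-point⇒primitive-solution {p})
  [ primitive-solution⇒rational-point {1} {p} {p + 2} ∘ Equivalence.to I⇔1
  , primitive-solution⇒rational-point {2} {p} {p + 2} ∘ Equivalence.to II⇔2 ]
  where
  I⇔1 = primaryI⇔primitive {p} {p + 2}
  II⇔2 = primaryII⇔primitive {p} {p + 2}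

-- Part (iii)

-- With Q = a² + b², r = εa + δb, w = ε² + δ² and C = (a + ε)² + (b + δ)² these say (Q + r)² − (Q − w)C = (r + w)²
-- and (Q + r)² − QC = −(aδ − bε)²; for units ε, δ one has w = 2.
shifted-norm-identity₁ : ∀ a b ε δ →
  (a ℤ.* a ℤ.+ b ℤ.* b ℤ.+ (ε ℤ.* a ℤ.+ δ ℤ.* b)) ℤ.* (a ℤ.* a ℤ.+ b ℤ.* b ℤ.+ (ε ℤ.* a ℤ.+ δ ℤ.* b))
  ℤ.- (a ℤ.* a ℤ.+ b ℤ.* b ℤ.- (ε ℤ.* ε ℤ.+ δ ℤ.* δ)) ℤ.* ((a ℤ.+ ε) ℤ.* (a ℤ.+ ε) ℤ.+ (b ℤ.+ δ) ℤ.* (b ℤ.+ δ))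
  ≡ (ε ℤ.* a ℤ.+ δ ℤ.* b ℤ.+ (ε ℤ.* ε ℤ.+ δ ℤ.* δ)) ℤ.* (ε ℤ.* a ℤ.+ δ ℤ.* b ℤ.+ (ε ℤ.* ε ℤ.+ δ ℤ.* δ))
shifted-norm-identity₁ = ℤ-Solver.solve-∀

shifted-norm-identity₂ : ∀ a b ε δ →
  (a ℤ.* a ℤ.+ b ℤ.* b ℤ.+ (ε ℤ.* a ℤ.+ δ ℤ.* b)) ℤ.* (a ℤ.* a ℤ.+ b ℤ.* b ℤ.+ (ε ℤ.* a ℤ.+ δ ℤ.* b))
  ℤ.- (a ℤ.* a ℤ.+ b ℤ.* b) ℤ.* ((a ℤ.+ ε) ℤ.* (a ℤ.+ ε) ℤ.+ (b ℤ.+ δ) ℤ.* (b ℤ.+ δ))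
  ≡ ℤ.- ((a ℤ.* δ ℤ.- b ℤ.* ε) ℤ.* (a ℤ.* δ ℤ.- b ℤ.* ε))
shifted-norm-identity₂ = ℤ-Solver.solve-∀

unit-square : ∀ {ε} → ε ≡ + 1 ⊎ ε ≡ -[1+ 0 ] → ε ℤ.* ε ≡ + 1
unit-square (inj₁ refl) = refl
unit-square (inj₂ refl) = refl

sum-of-squares≡0⇒≡0 : ∀ i j → i ℤ.* i ℤ.+ j ℤ.* j ≡ + 0 → i ≡ + 0
sum-of-squares≡0⇒≡0 i j eq = ℤ.∣i∣≡0⇒i≡0 (Sum.reduce (m*n≡0⇒m≡0∨n≡0 ℤ.∣ i ∣ ∣i∣²≡0))
  where
  ∣i∣²≡0 : ℤ.∣ i ∣ * ℤ.∣ i ∣ ≡ 0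
  ∣i∣²≡0 = m+n≡0⇒m≡0 _ (ℤ.+-injective (trans (sym (cong₂ ℤ._+_ (square-abs i) (square-abs j))) eq))

i+j≡0⇒i*i≡j*j : ∀ i j → i ℤ.+ j ≡ + 0 → i ℤ.* i ≡ j ℤ.* j
i+j≡0⇒i*i≡j*j i j eq = begin
  i ℤ.* i                               ≡⟨ difference-of-squares i j ⟩
  (i ℤ.+ j) ℤ.* (i ℤ.- j) ℤ.+ j ℤ.* j   ≡⟨ cong (λ s → s ℤ.* (i ℤ.- j) ℤ.+ j ℤ.* j) eq ⟩
  + 0 ℤ.* (i ℤ.- j) ℤ.+ j ℤ.* j         ≡⟨ ℤ.+-identityˡ (j ℤ.* j) ⟩
  j ℤ.* j                               ∎
  where
  open ≡-Reasoning
  difference-of-squares : ∀ i j → i ℤ.* i ≡ (i ℤ.+ j) ℤ.* (i ℤ.- j) ℤ.+ j ℤ.* j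
  difference-of-squares = ℤ-Solver.solve-∀

sum-of-two-squares⇒primitive-solution :
  ∀ {p} → Prime p → (a b c ε δ : ℤ) → (ε ≡ + 1 ⊎ ε ≡ -[1+ 0 ]) → (δ ≡ + 1 ⊎ δ ≡ -[1+ 0 ]) →
  + (p + 2) ≡ a ℤ.* a ℤ.+ b ℤ.* b → (a ℤ.+ ε) ℤ.* (a ℤ.+ ε) ℤ.+ (b ℤ.+ δ) ℤ.* (b ℤ.+ δ) ≡ c ℤ.* c →
  PrimitiveSolution 1 p (p + 2)
sum-of-two-squares⇒primitive-solution {p} p-prime a b c ε δ ε-unit δ-unit q≡Q C≡c² =
  system⇒primitive-solution {p} {p + 2} {ℤ.∣ X ∣} {ℤ.∣ c ∣} {ℤ.∣ S ∣} {ℤ.∣ T ∣} {{≢-nonZero ∣c∣≢0}}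
    (Equivalence.to (SystemI⇔System {p} {p + 2} X c S T) systemI)
  where
  open ≡-Reasoning
  Q = a ℤ.* a ℤ.+ b ℤ.* b
  r = ε ℤ.* a ℤ.+ δ ℤ.* b
  w = ε ℤ.* ε ℤ.+ δ ℤ.* δ
  C = (a ℤ.+ ε) ℤ.* (a ℤ.+ ε) ℤ.+ (b ℤ.+ δ) ℤ.* (b ℤ.+ δ)
  X = Q ℤ.+ r
  S = r ℤ.+ w
  T = a ℤ.* δ ℤ.- b ℤ.* ε
  Q-w≡p : Q ℤ.- w ≡ + p
  Q-w≡p = begin
    Q ℤ.- w               ≡⟨ cong₂ ℤ._-_ (sym q≡Q) (cong₂ ℤ._+_ (unit-square ε-unit) (unit-square δ-unit)) ⟩
    + p ℤ.+ + 2 ℤ.- + 2   ≡⟨ cancel (+ p) ⟩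
    + p                   ∎
    where
    cancel : ∀ i → i ℤ.+ + 2 ℤ.- + 2 ≡ i
    cancel = ℤ-Solver.solve-∀
  systemI : SystemI p (p + 2) X c S T
  systemI = subst₂ (λ P D → X ℤ.* X ℤ.- P ℤ.* D ≡ S ℤ.* S) Q-w≡p C≡c² (shifted-norm-identity₁ a b ε δ)
          , subst₂ (λ P D → X ℤ.* X ℤ.- P ℤ.* D ≡ ℤ.- (T ℤ.* T)) (sym q≡Q) C≡c² (shifted-norm-identity₂ a b ε δ)
  ∣c∣≢0 : ℤ.∣ c ∣ ≢ 0
  ∣c∣≢0 ∣c∣≡0 = ¬prime[0] (subst Prime (+-cancelʳ-≡ 2 p 0 (ℤ.+-injective q≡2)) p-prime)
    where
    C≡0 : C ≡ + 0
    C≡0 = trans C≡c² (cong (λ c → c ℤ.* c) (ℤ.∣i∣≡0⇒i≡0 {c} ∣c∣≡0))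
    a²≡1 : a ℤ.* a ≡ + 1
    a²≡1 = trans (i+j≡0⇒i*i≡j*j a ε (sum-of-squares≡0⇒≡0 (a ℤ.+ ε) (b ℤ.+ δ) C≡0)) (unit-square ε-unit)
    b²≡1 : b ℤ.* b ≡ + 1
    b²≡1 = trans (i+j≡0⇒i*i≡j*j b δ (sum-of-squares≡0⇒≡0 (b ℤ.+ δ) (a ℤ.+ ε) C′≡0)) (unit-square δ-unit)
      where
      C′≡0 = trans (ℤ.+-comm ((b ℤ.+ δ) ℤ.* (b ℤ.+ δ)) ((a ℤ.+ ε) ℤ.* (a ℤ.+ ε))) C≡0
    q≡2 : + (p + 2) ≡ + 2
    q≡2 = trans q≡Q (cong₂ ℤ._+_ a²≡1 b²≡1)

proposition4p1 : (p q : ℕ) → Prime p → Prime q → q ≡ p + 2 →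
    (HasIntegerPoint p q ⇔ (p ≡ 3))
    × (HasRationalPoint p q ⇔ (HasPrimarySolution (SystemI p q) ⊎ HasPrimarySolution (SystemII p q)))
    × ((a b c ε δ : ℤ) → (ε ≡ + 1 ⊎ ε ≡ -[1+ 0 ]) → (δ ≡ + 1 ⊎ δ ≡ -[1+ 0 ]) →
    + q ≡ a ℤ.* a ℤ.+ b ℤ.* b →
    (a ℤ.+ ε) ℤ.* (a ℤ.+ ε) ℤ.+ (b ℤ.+ δ) ℤ.* (b ℤ.+ δ) ≡ c ℤ.* c →
    HasPrimarySolution (SystemI p q) × HasRationalPoint p q)
proposition4p1 p .(p + 2) p-prime q-prime refl =
    integer-points {p} p-prime q-prime
  , rational-points {p}
  , λ a b c ε δ ε-unit δ-unit q≡a²+b² shifted≡c² →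
      let solution = sum-of-two-squares⇒primitive-solution {p} p-prime a b c ε δ ε-unit δ-unit q≡a²+b² shifted≡c²
      in Equivalence.from (primaryI⇔primitive {p} {p + 2}) solution , primitive-solution⇒rational-point {1} {p} {p + 2} solution
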